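{- Let $G$ be a bipartite graph with parts $A$ and $B$ such that $|E(G)|\ge 10$. Then $\mathrm{ISO}(G)\ge \frac{|E(G)|^2}{5|A||B|}$.
   Context: For a graph $G$, $\mathrm{ISO}(G)$ is the largest integer $s$ such that $G$ contains a pair of edge-disjoint isomorphic subgraphs with $s$ edges each. -}

module Defs where

open import Data.Nat using (ℕ; _+_; _*_)
open import Data.Bool using (Bool; true; false; if_then_else_)
open import Data.Fin using (Fin)
open import Data.List using (map; allFin)
open import Data.Nat.ListAction using (sum)
open import Data.Sum using (_⊎_; inj₁; inj₂)
open import Data.Product using (_×_; Σ; ∃; ∃-syntax)
open import Data.Empty using (⊥)
open import Relation.Nullary using (¬_)
open import Relation.Binary.PropositionalEquality using (_≡_)
open import Function.Bundles using (_↔_; Inverse)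
open import Function.Bundles using (_⇔_)

-- A (finite simple) bipartite graph with parts A = Fin a and B = Fin b is
-- given by its edge relation between A and B (every edge joins A to B).
BipGraph : ℕ → ℕ → Set
BipGraph a b = Fin a → Fin b → Bool

Vtx : ℕ → ℕ → Set
Vtx a b = Fin a ⊎ Fin b

edgeCount : ∀ {a b} → BipGraph a b → ℕ
edgeCount {a} {b} E =
  sum (map (λ i → sum (map (λ j → if E i j then 1 else 0) (allFin b))) (allFin a))

Adj : ∀ {a b} → BipGraph a b → Vtx a b → Vtx a b → Set
Adj E (inj₁ i) (inj₂ j) = E i j ≡ true
Adj E (inj₂ j) (inj₁ i) = E i j ≡ true
Adj E (inj₁ _) (inj₁ _) = ⊥
Adj E (inj₂ _) (inj₂ _) = ⊥

_⊆ᴳ_ : ∀ {a b} → BipGraph a b → BipGraph a b → Set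
H ⊆ᴳ G = ∀ i j → H i j ≡ true → G i j ≡ true

EdgeDisjoint : ∀ {a b} → BipGraph a b → BipGraph a b → Set
EdgeDisjoint H K = ∀ i j → ¬ (H i j ≡ true × K i j ≡ true)

-- Graph isomorphism: a bijection of vertices preserving and reflecting
-- adjacency (it may swap the two sides A and B).
Isomorphic : ∀ {a b} → BipGraph a b → BipGraph a b → Set
Isomorphic {a} {b} H K =
  Σ (Vtx a b ↔ Vtx a b) λ π →
    ∀ u v → Adj H u v ⇔ Adj K (Inverse.to π u) (Inverse.to π v)

HasIsoPair : ∀ {a b} → BipGraph a b → ℕ → Set
HasIsoPair G s =
  ∃[ H ] ∃[ K ] (H ⊆ᴳ G) × (K ⊆ᴳ G) × EdgeDisjoint H K
    × edgeCount H ≡ s × edgeCount K ≡ s × Isomorphic H K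

module Submission where

-- Identify A and B with ℤ/a and ℤ/b.  For c' ∈ ℤ/a, c ∈ ℤ/b the map
-- φ(i , j) = (c' − i , c − j) is an involution of A × B that also acts on the
-- vertices, so it maps every subgraph to an isomorphic one.  Enumerate the
-- edge slots A × B in row-major order and let H be the set of edges e of G
-- with φ(e) ∈ G and e preceding φ(e); then H and φ(H) are edge-disjoint
-- isomorphic subgraphs of G.  For a fixed pair of slots e < e' there is
-- exactly one (c' , c) with φ(e) = e', so summing |H| over all a·b choices of
-- (c' , c) counts the X ordered pairs of edges e < e'.  Expanding the square
-- of a sum gives e² = 2X + e, hence e² ≤ 5X, and some choice of (c' , c) has
-- |H| ≥ X / (a b).

open import Defs
open import Data.Bool using (Bool; true; false; if_then_else_; _∧_; T)
open import Data.Bool.Properties using (∧-conicalˡ; ∧-conicalʳ)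
open import Data.Fin using (Fin; zero; suc; toℕ; fromℕ<; combine; remQuot; _↑ˡ_; _↑ʳ_)
open import Data.Fin.Properties using (toℕ-injective; toℕ-fromℕ<; toℕ<n; remQuot-combine)
import Data.Fin.Permutation as Perm
open import Data.List using (map; tabulate)
open import Data.Nat using (ℕ; zero; suc; _+_; _*_; _∸_; _≤_; _<_; _<ᵇ_; NonZero; z≤n; s≤s)
open import Data.Nat.DivMod using (_%_; m%n<n; %-distribˡ-+; m%n%n≡m%n; [m+n]%n≡m%n; m<n⇒m%n≡m)
open import Data.Nat.ListAction using () renaming (sum to listSum)
open import Data.Nat.Properties
open import Data.Nat.Tactic.RingSolver using (solve-∀)
open import Data.Product using (_×_; ∃-syntax; _,_; proj₁; proj₂; uncurry)
open import Data.Unit using (tt)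
open import Data.Sum as Sum using (inj₁; inj₂)
open import Function using (_∘_; id)
open import Function.Bundles using (_⇔_; mk↔ₛ′; mk⇔)
open import Relation.Nullary using (yes; no)
open import Relation.Binary.PropositionalEquality
open import Algebra.Properties.Semiring.Sum +-*-semiring using (sum-syntax; sum-cong-≗; ∑-comm; ∑-permute; *-distribˡ-sum)

⟦_⟧ : Bool → ℕ
⟦ b ⟧ = if b then 1 else 0

⟦∧⟧ : ∀ x y → ⟦ x ∧ y ⟧ ≡ ⟦ x ⟧ * ⟦ y ⟧
⟦∧⟧ true  y = sym (*-identityˡ ⟦ y ⟧)
⟦∧⟧ false y = refl

⟦⟧-idempotent : ∀ x → ⟦ x ⟧ * ⟦ x ⟧ ≡ ⟦ x ⟧
⟦⟧-idempotent true  = refl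
⟦⟧-idempotent false = refl

∑-mono : ∀ {n} {f g : Fin n → ℕ} → (∀ i → f i ≤ g i) → ∑[ i < n ] f i ≤ ∑[ i < n ] g i
∑-mono {zero}  f≤g = z≤n
∑-mono {suc n} f≤g = +-mono-≤ (f≤g zero) (∑-mono (f≤g ∘ suc))

∑-const : ∀ n c → ∑[ i < n ] c ≡ n * c
∑-const zero    c = refl
∑-const (suc n) c = cong (c +_) (∑-const n c)

∑-*ˡ : ∀ {n} c (f : Fin n → ℕ) → ∑[ i < n ] (c * f i) ≡ c * ∑[ i < n ] f i
∑-*ˡ c f = sym (*-distribˡ-sum c f)

∑-↑ : ∀ m n (f : Fin (m + n) → ℕ) →
  ∑[ k < m + n ] f k ≡ ∑[ i < m ] f (i ↑ˡ n) + ∑[ j < n ] f (m ↑ʳ j)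
∑-↑ zero    n f = refl
∑-↑ (suc m) n f = trans (cong (f zero +_) (∑-↑ m n (f ∘ suc)))
  (sym (+-assoc (f zero) _ _))

∑-combine : ∀ m n (f : Fin (m * n) → ℕ) →
  ∑[ i < m ] ∑[ j < n ] f (combine i j) ≡ ∑[ k < m * n ] f k
∑-combine zero    n f = refl
∑-combine (suc m) n f = begin
    ∑[ j < n ] f (j ↑ˡ m * n) + ∑[ i < m ] ∑[ j < n ] f (n ↑ʳ combine i j)
  ≡⟨ cong (∑[ j < n ] f (j ↑ˡ m * n) +_) (∑-combine m n (f ∘ (n ↑ʳ_))) ⟩
    ∑[ j < n ] f (j ↑ˡ m * n) + ∑[ k < m * n ] f (n ↑ʳ k)
  ≡⟨ ∑-↑ n (m * n) f ⟨
    ∑[ k < suc m * n ] f k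
  ∎
  where open ≡-Reasoning

∑-bijection : ∀ {n} (f : Fin n → ℕ) (p q : Fin n → Fin n) →
  (∀ y → p (q y) ≡ y) → (∀ x → q (p x) ≡ x) → ∑[ i < n ] f (p i) ≡ ∑[ i < n ] f i
∑-bijection f p q pq qp = sym (∑-permute f (Perm.permutation p q pq qp))

∑²-comm : ∀ {m n p q} (F : Fin m → Fin n → Fin p → Fin q → ℕ) →
  ∑[ x < m ] ∑[ y < n ] ∑[ i < p ] ∑[ j < q ] F x y i j ≡
  ∑[ i < p ] ∑[ j < q ] ∑[ x < m ] ∑[ y < n ] F x y i j
∑²-comm {m} {n} {p} {q} F = begin
    ∑[ x < m ] ∑[ y < n ] ∑[ i < p ] ∑[ j < q ] F x y i j
  ≡⟨ sum-cong-≗ (λ x → ∑-comm (λ y i → ∑[ j < q ] F x y i j)) ⟩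
    ∑[ x < m ] ∑[ i < p ] ∑[ y < n ] ∑[ j < q ] F x y i j
  ≡⟨ ∑-comm (λ x i → ∑[ y < n ] ∑[ j < q ] F x y i j) ⟩
    ∑[ i < p ] ∑[ x < m ] ∑[ y < n ] ∑[ j < q ] F x y i j
  ≡⟨ sum-cong-≗ (λ i → sum-cong-≗ (λ x → ∑-comm (λ y j → F x y i j))) ⟩
    ∑[ i < p ] ∑[ x < m ] ∑[ j < q ] ∑[ y < n ] F x y i j
  ≡⟨ sum-cong-≗ (λ i → ∑-comm (λ x j → ∑[ y < n ] F x y i j)) ⟩
    ∑[ i < p ] ∑[ j < q ] ∑[ x < m ] ∑[ y < n ] F x y i j
  ∎
  where open ≡-Reasoning

listSum-tabulate : ∀ {A : Set} n (f : A → ℕ) (h : Fin n → A) →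
  listSum (map f (tabulate h)) ≡ ∑[ i < n ] f (h i)
listSum-tabulate zero    f h = refl
listSum-tabulate (suc n) f h = cong (f (h zero) +_) (listSum-tabulate n f (h ∘ suc))

edgeCount-∑ : ∀ {a b} (E : BipGraph a b) → edgeCount E ≡ ∑[ i < a ] ∑[ j < b ] ⟦ E i j ⟧
edgeCount-∑ {a} {b} E =
  trans (listSum-tabulate a (λ i → listSum (map (λ j → ⟦ E i j ⟧) (tabulate id))) id)
    (sum-cong-≗ (λ i → listSum-tabulate b (λ j → ⟦ E i j ⟧) id))

orderedPairs : ∀ {n} → (Fin n → ℕ) → ℕ
orderedPairs {n} f = ∑[ k < n ] ∑[ l < n ] (⟦ toℕ k <ᵇ toℕ l ⟧ * (f k * f l))

orderedPairs-suc : ∀ {n} (f : Fin (suc n) → ℕ) →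
  orderedPairs f ≡ f zero * ∑[ l < n ] f (suc l) + orderedPairs (f ∘ suc)
orderedPairs-suc {n} f = cong (_+ orderedPairs (f ∘ suc))
  (trans (sum-cong-≗ (λ l → *-identityˡ (f zero * f (suc l)))) (∑-*ˡ (f zero) (f ∘ suc)))

square-of-sum : ∀ {n} (f : Fin n → ℕ) →
  ∑[ k < n ] f k * ∑[ k < n ] f k ≡ 2 * orderedPairs f + ∑[ k < n ] (f k * f k)
square-of-sum {zero}  f = refl
square-of-sum {suc n} f = begin
    (x + s) * (x + s)
  ≡⟨ expand x s ⟩
    2 * (x * s) + x * x + s * s
  ≡⟨ cong (2 * (x * s) + x * x +_) (square-of-sum (f ∘ suc)) ⟩
    2 * (x * s) + x * x + (2 * p + q)
  ≡⟨ regroup (x * s) (x * x) p q ⟩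
    2 * (x * s + p) + (x * x + q)
  ≡⟨ cong (λ t → 2 * t + (x * x + q)) (orderedPairs-suc f) ⟨
    2 * orderedPairs f + (x * x + q)
  ∎
  where
  open ≡-Reasoning
  x = f zero
  s = ∑[ k < n ] f (suc k)
  p = orderedPairs (f ∘ suc)
  q = ∑[ k < n ] (f (suc k) * f (suc k))
  expand : ∀ x s → (x + s) * (x + s) ≡ 2 * (x * s) + x * x + s * s
  expand = solve-∀
  regroup : ∀ y z p q → 2 * y + z + (2 * p + q) ≡ 2 * (y + p) + (z + q)
  regroup = solve-∀

argmax : ∀ {n} (f : Fin (suc n) → ℕ) → ∃[ k ] (∀ i → f i ≤ f k)
argmax {zero}  f = zero , λ { zero → ≤-refl }
argmax {suc n} f with argmax (f ∘ suc)
... | k , f≤fk with f zero ≤? f (suc k)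
...   | yes f0≤ = suc k , λ { zero → f0≤ ; (suc i) → f≤fk i }
...   | no  f0≰ = zero  , λ { zero → ≤-refl ; (suc i) → ≤-trans (f≤fk i) (<⇒≤ (≰⇒> f0≰)) }

averaging : ∀ {n} (f : Fin n → ℕ) → 0 < ∑[ i < n ] f i → ∃[ k ] ∑[ i < n ] f i ≤ n * f k
averaging {suc n} f _ = let (k , f≤fk) = argmax f in
  k , ≤-trans (∑-mono f≤fk) (≤-reflexive (∑-const (suc n) (f k)))

averaging² : ∀ {m n} (f : Fin m → Fin n → ℕ) → 0 < ∑[ x < m ] ∑[ y < n ] f x y →
  ∃[ x ] ∃[ y ] ∑[ x < m ] ∑[ y < n ] f x y ≤ m * n * f x y
averaging² {m} {n} f pos =
  let (k , avg) = averaging g (subst (0 <_) enumerate pos) in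
  proj₁ (remQuot {m} n k) , proj₂ (remQuot {m} n k) , subst (_≤ m * n * g k) (sym enumerate) avg
  where
  g : Fin (m * n) → ℕ
  g k = uncurry f (remQuot {m} n k)
  enumerate : ∑[ x < m ] ∑[ y < n ] f x y ≡ ∑[ k < m * n ] g k
  enumerate = trans
    (sum-cong-≗ (λ x → sum-cong-≗ (λ y → cong (uncurry f) (sym (remQuot-combine x y)))))
    (∑-combine m n g)

%-round-trip : ∀ {n} .{{_ : NonZero n}} x u v → x < n → u + v ≡ n →
  ((x + u) % n + v) % n ≡ x
%-round-trip {n} x u v x<n u+v≡n = begin
    ((x + u) % n + v) % n          ≡⟨ %-distribˡ-+ ((x + u) % n) v n ⟩
    ((x + u) % n % n + v % n) % n  ≡⟨ cong (λ t → (t + v % n) % n) (m%n%n≡m%n (x + u) n) ⟩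
    ((x + u) % n + v % n) % n      ≡⟨ %-distribˡ-+ (x + u) v n ⟨
    (x + u + v) % n                ≡⟨ cong (_% n) (trans (+-assoc x u v) (cong (x +_) u+v≡n)) ⟩
    (x + n) % n                    ≡⟨ [m+n]%n≡m%n x n ⟩
    x % n                          ≡⟨ m<n⇒m%n≡m x<n ⟩
    x
  ∎
  where open ≡-Reasoning

-- Addition in ℤ/n, and the reflection  reflect c j = c − j  of ℤ/n about c/2.
_⊕_ : ∀ {n} → Fin n → Fin n → Fin n
_⊕_ {suc n} x y = fromℕ< (m%n<n (toℕ x + toℕ y) (suc n))

reflect : ∀ {n} → Fin n → Fin n → Fin n
reflect {suc n} c j = fromℕ< (m%n<n (toℕ c + (suc n ∸ toℕ j)) (suc n))

toℕ-⊕ : ∀ {n} (x y : Fin (suc n)) → toℕ (x ⊕ y) ≡ (toℕ x + toℕ y) % suc n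
toℕ-⊕ {n} x y = toℕ-fromℕ< (m%n<n (toℕ x + toℕ y) (suc n))

toℕ-reflect : ∀ {n} (c j : Fin (suc n)) → toℕ (reflect c j) ≡ (toℕ c + (suc n ∸ toℕ j)) % suc n
toℕ-reflect {n} c j = toℕ-fromℕ< (m%n<n (toℕ c + (suc n ∸ toℕ j)) (suc n))

⊕-comm : ∀ {n} (x y : Fin n) → x ⊕ y ≡ y ⊕ x
⊕-comm {suc n} x y = toℕ-injective (begin
    toℕ (x ⊕ y)                 ≡⟨ toℕ-⊕ x y ⟩
    (toℕ x + toℕ y) % suc n     ≡⟨ cong (_% suc n) (+-comm (toℕ x) (toℕ y)) ⟩
    (toℕ y + toℕ x) % suc n     ≡⟨ toℕ-⊕ y x ⟨
    toℕ (y ⊕ x)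
  ∎)
  where open ≡-Reasoning

reflect-⊕ : ∀ {n} (k j : Fin n) → reflect (k ⊕ j) j ≡ k
reflect-⊕ {suc n} k j = toℕ-injective (begin
    toℕ (reflect (k ⊕ j) j)                              ≡⟨ toℕ-reflect (k ⊕ j) j ⟩
    (toℕ (k ⊕ j) + (suc n ∸ toℕ j)) % suc n              ≡⟨ cong (λ t → (t + (suc n ∸ toℕ j)) % suc n) (toℕ-⊕ k j) ⟩
    ((toℕ k + toℕ j) % suc n + (suc n ∸ toℕ j)) % suc n  ≡⟨ %-round-trip (toℕ k) (toℕ j) _ (toℕ<n k) (m+[n∸m]≡n (<⇒≤ (toℕ<n j))) ⟩
    toℕ k
  ∎)
  where open ≡-Reasoning

⊕-reflect : ∀ {n} (c j : Fin n) → reflect c j ⊕ j ≡ c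
⊕-reflect {suc n} c j = toℕ-injective (begin
    toℕ (reflect c j ⊕ j)                                ≡⟨ toℕ-⊕ (reflect c j) j ⟩
    (toℕ (reflect c j) + toℕ j) % suc n                  ≡⟨ cong (λ t → (t + toℕ j) % suc n) (toℕ-reflect c j) ⟩
    ((toℕ c + (suc n ∸ toℕ j)) % suc n + toℕ j) % suc n  ≡⟨ %-round-trip (toℕ c) _ (toℕ j) (toℕ<n c) (m∸n+n≡m (<⇒≤ (toℕ<n j))) ⟩
    toℕ c
  ∎)
  where open ≡-Reasoning

reflect-involutive : ∀ {n} (c j : Fin n) → reflect c (reflect c j) ≡ j
reflect-involutive c j = begin
    reflect c (reflect c j)                ≡⟨ cong (λ t → reflect t (reflect c j)) (⊕-reflect c j) ⟨
    reflect (reflect c j ⊕ j) (reflect c j)  ≡⟨ cong (λ t → reflect t (reflect c j)) (⊕-comm (reflect c j) j) ⟩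
    reflect (j ⊕ reflect c j) (reflect c j)  ≡⟨ reflect-⊕ j (reflect c j) ⟩
    j
  ∎
  where open ≡-Reasoning

-- For fixed j the centre c ↦ c − j is a bijection, so averaging over all
-- reflections visits every point exactly once.
∑-reflect : ∀ {n} (j : Fin n) (f : Fin n → ℕ) → ∑[ c < n ] f (reflect c j) ≡ ∑[ k < n ] f k
∑-reflect j f = ∑-bijection f (λ c → reflect c j) (_⊕ j) (λ k → reflect-⊕ k j) (λ c → ⊕-reflect c j)

relabel : ∀ {a b} → BipGraph a b → (Fin a → Fin a) → (Fin b → Fin b) → BipGraph a b
relabel H σ τ i j = H (σ i) (τ j)

relabel-isomorphic : ∀ {a b} (H : BipGraph a b) {σ : Fin a → Fin a} {τ : Fin b → Fin b} →
  (∀ i → σ (σ i) ≡ i) → (∀ j → τ (τ j) ≡ j) → Isomorphic H (relabel H σ τ)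
relabel-isomorphic {a} {b} H {σ} {τ} σσ ττ = mk↔ₛ′ φ φ φφ φφ , adjacency
  where
  φ : Vtx a b → Vtx a b
  φ = Sum.map σ τ
  φφ : ∀ v → φ (φ v) ≡ v
  φφ (inj₁ i) = cong inj₁ (σσ i)
  φφ (inj₂ j) = cong inj₂ (ττ j)
  edge : ∀ i j → (H i j ≡ true) ⇔ (H (σ (σ i)) (τ (τ j)) ≡ true)
  edge i j = mk⇔ (subst₂ (λ x y → H x y ≡ true) (sym (σσ i)) (sym (ττ j)))
                 (subst₂ (λ x y → H x y ≡ true) (σσ i) (ττ j))
  adjacency : ∀ u v → Adj H u v ⇔ Adj (relabel H σ τ) (φ u) (φ v)
  adjacency (inj₁ i) (inj₂ j) = edge i j
  adjacency (inj₂ j) (inj₁ i) = edge i j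
  adjacency (inj₁ _) (inj₁ _) = mk⇔ id id
  adjacency (inj₂ _) (inj₂ _) = mk⇔ id id

relabel-edgeCount : ∀ {a b} (H : BipGraph a b) {σ : Fin a → Fin a} {τ : Fin b → Fin b} →
  (∀ i → σ (σ i) ≡ i) → (∀ j → τ (τ j) ≡ j) → edgeCount (relabel H σ τ) ≡ edgeCount H
relabel-edgeCount {a} {b} H {σ} {τ} σσ ττ = begin
    edgeCount (relabel H σ τ)               ≡⟨ edgeCount-∑ (relabel H σ τ) ⟩
    ∑[ i < a ] ∑[ j < b ] ⟦ H (σ i) (τ j) ⟧  ≡⟨ sum-cong-≗ (λ i → ∑-bijection (λ j → ⟦ H (σ i) j ⟧) τ τ ττ ττ) ⟩
    ∑[ i < a ] ∑[ j < b ] ⟦ H (σ i) j ⟧      ≡⟨ ∑-bijection (λ i → ∑[ j < b ] ⟦ H i j ⟧) σ σ σσ σσ ⟩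
    ∑[ i < a ] ∑[ j < b ] ⟦ H i j ⟧          ≡⟨ edgeCount-∑ H ⟨
    edgeCount H
  ∎
  where open ≡-Reasoning

slotIndex : ∀ {a b} → Fin a → Fin b → ℕ
slotIndex i j = toℕ (combine i j)

ascending : ∀ {a b} → BipGraph a b → (Fin a → Fin a) → (Fin b → Fin b) → BipGraph a b
ascending G σ τ i j = (slotIndex i j <ᵇ slotIndex (σ i) (τ j)) ∧ G i j ∧ G (σ i) (τ j)

<ᵇ-true⇒< : ∀ {m n} → (m <ᵇ n) ≡ true → m < n
<ᵇ-true⇒< {m} {n} m<ᵇn = <ᵇ⇒< m n (subst T (sym m<ᵇn) tt)

ascending-edge : ∀ {a b} (G : BipGraph a b) (σ : Fin a → Fin a) (τ : Fin b → Fin b) i j →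
  ascending G σ τ i j ≡ true →
  slotIndex i j < slotIndex (σ i) (τ j) × G i j ≡ true × G (σ i) (τ j) ≡ true
ascending-edge G σ τ i j h =
  <ᵇ-true⇒< (∧-conicalˡ earlier rest h) ,
  ∧-conicalˡ (G i j) (G (σ i) (τ j)) (∧-conicalʳ earlier rest h) ,
  ∧-conicalʳ (G i j) (G (σ i) (τ j)) (∧-conicalʳ earlier rest h)
  where
  earlier = slotIndex i j <ᵇ slotIndex (σ i) (τ j)
  rest = G i j ∧ G (σ i) (τ j)

-- For involutions σ, τ the ascending edges H and their image under σ × τ
-- form an edge-disjoint isomorphic pair: an edge of both would precede its
-- image and be preceded by it.
ascending-isoPair : ∀ {a b} (G : BipGraph a b) {σ : Fin a → Fin a} {τ : Fin b → Fin b} →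
  (∀ i → σ (σ i) ≡ i) → (∀ j → τ (τ j) ≡ j) → HasIsoPair G (edgeCount (ascending G σ τ))
ascending-isoPair G {σ} {τ} σσ ττ =
  H , relabel H σ τ , H⊆G , K⊆G , disjoint , refl ,
  relabel-edgeCount H σσ ττ , relabel-isomorphic H σσ ττ
  where
  H = ascending G σ τ
  H⊆G : H ⊆ᴳ G
  H⊆G i j h = proj₁ (proj₂ (ascending-edge G σ τ i j h))
  K⊆G : relabel H σ τ ⊆ᴳ G
  K⊆G i j k = subst₂ (λ x y → G x y ≡ true) (σσ i) (ττ j)
    (proj₂ (proj₂ (ascending-edge G σ τ (σ i) (τ j) k)))
  disjoint : EdgeDisjoint H (relabel H σ τ)
  disjoint i j (h , k) = <-asym (proj₁ (ascending-edge G σ τ i j h))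
    (subst₂ (λ x y → slotIndex (σ i) (τ j) < slotIndex x y) (σσ i) (ττ j)
      (proj₁ (ascending-edge G σ τ (σ i) (τ j) k)))

slot : ∀ {a b} → BipGraph a b → Fin (a * b) → ℕ
slot {a} {b} G k = ⟦ uncurry G (remQuot {a} b k) ⟧

slot-combine : ∀ {a b} (G : BipGraph a b) i j → slot G (combine i j) ≡ ⟦ G i j ⟧
slot-combine G i j = cong (⟦_⟧ ∘ uncurry G) (remQuot-combine i j)

edgeCount-slots : ∀ {a b} (G : BipGraph a b) → edgeCount G ≡ ∑[ k < a * b ] slot G k
edgeCount-slots {a} {b} G = trans (edgeCount-∑ G) (trans
  (sum-cong-≗ (λ i → sum-cong-≗ (λ j → sym (slot-combine G i j))))
  (∑-combine a b (slot G)))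

edgeCount-square : ∀ {a b} (G : BipGraph a b) →
  edgeCount G * edgeCount G ≡ 2 * orderedPairs (slot G) + edgeCount G
edgeCount-square {a} {b} G = begin
    edgeCount G * edgeCount G
  ≡⟨ cong₂ _*_ (edgeCount-slots G) (edgeCount-slots G) ⟩
    ∑[ k < a * b ] slot G k * ∑[ k < a * b ] slot G k
  ≡⟨ square-of-sum (slot G) ⟩
    2 * orderedPairs (slot G) + ∑[ k < a * b ] (slot G k * slot G k)
  ≡⟨ cong (2 * orderedPairs (slot G) +_)
       (trans (sum-cong-≗ (λ k → ⟦⟧-idempotent (uncurry G (remQuot {a} b k)))) (sym (edgeCount-slots G))) ⟩
    2 * orderedPairs (slot G) + edgeCount G
  ∎
  where open ≡-Reasoning

reflectedCount : ∀ {a b} → BipGraph a b → Fin a → Fin b → ℕ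
reflectedCount G c' c = edgeCount (ascending G (reflect c') (reflect c))

-- Double count: every pair of edge slots e < e' is (e , φ e) for exactly one
-- pair of reflections, so the counts over all a·b reflections add up to X.
∑-reflectedCount : ∀ {a b} (G : BipGraph a b) →
  ∑[ c' < a ] ∑[ c < b ] reflectedCount G c' c ≡ orderedPairs (slot G)
∑-reflectedCount {a} {b} G = begin
    ∑[ c' < a ] ∑[ c < b ] reflectedCount G c' c
  ≡⟨ sum-cong-≗ (λ c' → sum-cong-≗ (λ c → trans (edgeCount-∑ (ascending G (reflect c') (reflect c)))
       (sum-cong-≗ (λ i → sum-cong-≗ (λ j → ⟦ascending⟧ c' c i j))))) ⟩
    ∑[ c' < a ] ∑[ c < b ] ∑[ i < a ] ∑[ j < b ] pair i j (reflect c' i) (reflect c j)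
  ≡⟨ ∑²-comm (λ c' c i j → pair i j (reflect c' i) (reflect c j)) ⟩
    ∑[ i < a ] ∑[ j < b ] ∑[ c' < a ] ∑[ c < b ] pair i j (reflect c' i) (reflect c j)
  ≡⟨ sum-cong-≗ (λ i → sum-cong-≗ (λ j → trans
       (sum-cong-≗ (λ c' → ∑-reflect j (pair i j (reflect c' i))))
       (∑-reflect i (λ i' → ∑[ j' < b ] pair i j i' j')))) ⟩
    ∑[ i < a ] ∑[ j < b ] ∑[ i' < a ] ∑[ j' < b ] pair i j i' j'
  ≡⟨ sum-cong-≗ (λ i → sum-cong-≗ (λ j → trans
       (sum-cong-≗ (λ i' → sum-cong-≗ (λ j' → pair-combine i j i' j')))
       (∑-combine a b (λ l → slotPair (combine i j) l)))) ⟩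
    ∑[ i < a ] ∑[ j < b ] ∑[ l < a * b ] slotPair (combine i j) l
  ≡⟨ ∑-combine a b (λ k → ∑[ l < a * b ] slotPair k l) ⟩
    orderedPairs (slot G)
  ∎
  where
  open ≡-Reasoning
  pair : Fin a → Fin b → Fin a → Fin b → ℕ
  pair i j i' j' = ⟦ slotIndex i j <ᵇ slotIndex i' j' ⟧ * (⟦ G i j ⟧ * ⟦ G i' j' ⟧)
  slotPair : Fin (a * b) → Fin (a * b) → ℕ
  slotPair k l = ⟦ toℕ k <ᵇ toℕ l ⟧ * (slot G k * slot G l)
  ⟦ascending⟧ : ∀ c' c i j →
    ⟦ ascending G (reflect c') (reflect c) i j ⟧ ≡ pair i j (reflect c' i) (reflect c j)
  ⟦ascending⟧ c' c i j = trans (⟦∧⟧ earlier (G i j ∧ G i' j')) (cong (⟦ earlier ⟧ *_) (⟦∧⟧ (G i j) (G i' j')))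
    where
    i' = reflect c' i
    j' = reflect c j
    earlier = slotIndex i j <ᵇ slotIndex i' j'
  pair-combine : ∀ i j i' j' → pair i j i' j' ≡ slotPair (combine i j) (combine i' j')
  pair-combine i j i' j' = cong₂ (λ u v → ⟦ slotIndex i j <ᵇ slotIndex i' j' ⟧ * (u * v))
    (sym (slot-combine G i j)) (sym (slot-combine G i' j'))

-- If e² = 2X + e and e ≥ 2, then 2X = e(e − 1) ≥ e ...
pairs-dominate : ∀ e p → 2 ≤ e → e * e ≡ 2 * p + e → e ≤ 2 * p
pairs-dominate (suc d) p (s≤s 1≤d) e²≡2p+e = begin
    suc d      ≡⟨ *-identityˡ (suc d) ⟨
    1 * suc d  ≤⟨ *-monoˡ-≤ (suc d) 1≤d ⟩
    d * suc d  ≡⟨ +-cancelˡ-≡ (suc d) (d * suc d) (2 * p) (trans e²≡2p+e (+-comm (2 * p) (suc d))) ⟩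
    2 * p
  ∎
  where open ≤-Reasoning

square-bound : ∀ e p → e * e ≡ 2 * p + e → e ≤ 2 * p → e * e ≤ 5 * p
square-bound e p e²≡2p+e e≤2p = begin
    e * e          ≡⟨ e²≡2p+e ⟩
    2 * p + e      ≤⟨ +-monoʳ-≤ (2 * p) e≤2p ⟩
    2 * p + 2 * p  ≡⟨ double p ⟩
    4 * p          ≤⟨ *-monoˡ-≤ p (n≤1+n 4) ⟩
    5 * p
  ∎
  where
  open ≤-Reasoning
  double : ∀ p → 2 * p + 2 * p ≡ 4 * p
  double = solve-∀

corollary2p6 : (a b : ℕ) (G : BipGraph a b) → 10 ≤ edgeCount G →
    ∃[ s ] (HasIsoPair G s × edgeCount G * edgeCount G ≤ 5 * a * b * s)
corollary2p6 a b G 10≤e =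
  reflectedCount G c' c , ascending-isoPair G (reflect-involutive c') (reflect-involutive c) , bound
  where
  e = edgeCount G
  X = orderedPairs (slot G)
  e≤2X : e ≤ 2 * X
  e≤2X = pairs-dominate e X (≤-trans (s≤s (s≤s z≤n)) 10≤e) (edgeCount-square G)
  X>0 : 0 < X
  X>0 = *-cancelˡ-< 2 0 X (≤-trans (≤-trans (s≤s z≤n) 10≤e) e≤2X)
  average = averaging² (reflectedCount G) (subst (0 <_) (sym (∑-reflectedCount G)) X>0)
  c' = proj₁ average
  c = proj₁ (proj₂ average)
  s = reflectedCount G c' c
  bound : e * e ≤ 5 * a * b * s
  bound = begin
    e * e                                              ≤⟨ square-bound e X (edgeCount-square G) e≤2X ⟩
    5 * X                                              ≡⟨ cong (5 *_) (∑-reflectedCount G) ⟨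
    5 * ∑[ x < a ] ∑[ y < b ] reflectedCount G x y     ≤⟨ *-monoʳ-≤ 5 (proj₂ (proj₂ average)) ⟩
    5 * (a * b * s)                                    ≡⟨ *-assoc 5 (a * b) s ⟨
    5 * (a * b) * s                                    ≡⟨ cong (_* s) (*-assoc 5 a b) ⟨
    5 * a * b * s
    ∎
    where open ≤-Reasoning
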